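{- Let $p$ and $q$ be positive integers with $p<q$ such that $q-p$ and $p+q$ are relatively prime. Let $W$ be the graph whose vertices are the cells $(x,y)$, $0\le x,y\le 2(p+q)-1$, of the square board of side $2(p+q)$, two cells being adjacent if and only if they differ by one of $(\pm p,\pm q)$, $(\pm q,\pm p)$. Then $W$ has a two-factor, i.e. a spanning subgraph in which every vertex has degree exactly $2$.
   Context: $W$ is the move graph of the $(p,q)$-leaper on the $2(p+q)\times2(p+q)$ board. A two-factor (pseudotour) is a spanning subgraph with all degrees equal to two, i.e. a disjoint union of cycles covering all vertices. -}

module Defs where

open import Data.Nat using (ℕ; _+_; _*_)
open import Data.Fin using (Fin; toℕ)
open import Data.Integer using (ℤ; +_; -_; _-_)
open import Data.Product using (_×_; _,_; ∃; ∃-syntax)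
open import Data.Sum using (_⊎_)
open import Relation.Binary.PropositionalEquality using (_≡_; _≢_)

side : ℕ → ℕ → ℕ
side p q = 2 * (p + q)

Cell : ℕ → Set
Cell n = Fin n × Fin n

δ : ∀ {n} → Fin n → Fin n → ℤ
δ a b = + toℕ b - + toℕ a

PlusMinus : ℤ → ℤ → ℕ → ℕ → Set
PlusMinus dx dy a b = (dx ≡ + a ⊎ dx ≡ - (+ a)) × (dy ≡ + b ⊎ dy ≡ - (+ b))

Leap : ℕ → ℕ → ∀ {n} → Cell n → Cell n → Set
Leap p q (x₁ , y₁) (x₂ , y₂) =
  PlusMinus (δ x₁ x₂) (δ y₁ y₂) p q ⊎ PlusMinus (δ x₁ x₂) (δ y₁ y₂) q p

DegreeTwo : ∀ {V : Set} → (V → V → Set) → V → Set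
DegreeTwo {V} F v =
  ∃[ u₁ ] ∃[ u₂ ] (u₁ ≢ u₂ × F v u₁ × F v u₂ ×
    (∀ w → F v w → w ≡ u₁ ⊎ w ≡ u₂))

TwoFactor : ∀ {V : Set} → (V → V → Set) → Set₁
TwoFactor {V} E =
  ∃[ F ] ((∀ u v → F u v → E u v) × (∀ u v → F u v → F v u) ×
          (∀ v → DegreeTwo F v))

W : (p q : ℕ) → Cell (side p q) → Cell (side p q) → Set
W p q = Leap p q

module Submission where

open import Defs
open import Data.Nat using (ℕ; _+_; _∸_; _<_)
open import Data.Nat.Coprimality using (Coprime)

open import Data.Bool using (Bool; true; false; not; _∧_; _∨_; _xor_; T)
open import Data.Bool.Properties
  using (T?; T-∧; not-injective; xor-assoc; xor-same; xor-identityʳ) renaming (_≟_ to _≟ᵇ_)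
open import Data.Fin using (Fin; zero; suc; toℕ; fromℕ<; combine; remQuot)
open import Data.Fin.Properties using (toℕ-fromℕ<; toℕ<n; toℕ-injective; combine-remQuot; toℕ-combine)
open import Data.Integer using (ℤ; +_; -_; _-_; _⊖_)
open import Data.Integer.Properties using (neg-involutive; [+m]-[+n]≡m⊖n; ⊖-swap; ⊖-≥; ⊖-≤)
open import Data.Nat using (_≤_; _<?_)
open import Data.Nat.Properties
  using (+-comm; +-assoc; +-identityʳ; *-zeroʳ; *-identityʳ; +-cancelˡ-≡; ∸-cancelˡ-≡;
         m≤m+n; m≤n+m; m<m+n; m∸n≤m; m+n∸n≡m; m+n∸m≡n; m∸n+n≡m; +-monoˡ-<; +-monoʳ-<; ∸-monoˡ-<;
         ≤-<-trans; <-≤-trans; <-trans; ≮⇒≥; ≤⇒≯; <⇒≱; <⇒≢)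
open import Data.Nat.Tactic.RingSolver using (solve-∀)
open import Data.Product using (_×_; _,_; proj₁; proj₂; ∃-syntax)
open import Data.Product.Properties using (≡-dec)
open import Data.Sum using (_⊎_; inj₁; inj₂)
open import Data.Unit using (⊤; tt)
open import Function.Bundles using (Equivalence)
open import Relation.Binary.Definitions using (DecidableEquality)
open import Relation.Binary.PropositionalEquality
  using (_≡_; _≢_; refl; sym; trans; cong; cong₂; subst; subst₂; module ≡-Reasoning)
open import Relation.Nullary using (Dec; yes; no; ¬_; ¬?; contradiction)
open import Relation.Nullary.Decidable using (map′; toWitness; _×-dec_; _⊎-dec_; _→-dec_)

-- Theorem: for 0 < p < q the (p,q)-leaper graph on the 2s × 2s board, s = p + q,
-- has a two-factor.
--
-- Write a board coordinate x < 2s as x = h·s + u with a half h and a position u < s.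
-- As q ≡ -p (mod s), each coordinate displacement ±p, ±q moves the position one step
-- forwards or backwards along the rotation u ↦ u + p (mod s), possibly switching the
-- half.  Whether such a one-coordinate move is legal, and whether its length is p or
-- q, is read off from a local view: the half and the labels [v < q] of the positions
-- u - 2p, u - p, u, u + p.  Along the rotation no two consecutive labels are false,
-- and this is all the argument knows about them.

-- A one-coordinate move: (rotate forwards? , switch half?).
Move : Set
Move = Bool × Bool

F₀ F₁ B₀ B₁ : Move
F₀ = true  , false
F₁ = true  , true
B₀ = false , false
B₁ = false , true

reverse : Move → Move
reverse (d , c) = not d , c

-- Labels of the positions u - 2p, u - p, u, u + p along the rotation.
Window : Set
Window = Bool × Bool × Bool × Bool

previous current : Window → Bool
previous (_ , b , _ , _) = b
current  (_ , _ , c , _) = c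

Admissible : Window → Set
Admissible (a , b , c , d) = T ((a ∨ b) ∧ (b ∨ c) ∧ (c ∨ d))

-- The window after a move, n being the label that comes into sight.
shift : Move → Window → Bool → Window
shift (true  , _) (_ , b , c , d) n = b , c , d , n
shift (false , _) (a , b , c , _) n = n , a , b , c

-- The local view of a coordinate: its half and its window.
View : Set
View = Bool × Window

after : Move → View → Bool → View
after (d , c) (h , w) n = h xor c , shift (d , c) w n

Valid : Move → View → Set
Valid (_     , false) _       = ⊤
Valid (true  , true)  (h , w) = h ≡ current w
Valid (false , true)  (h , w) = h ≡ not (previous w)

-- Length of a move: true for a displacement ±p, false for ±q.
stepType : Move → Window → Bool
stepType (true  , c) w = current w xor c
stepType (false , c) w = previous w xor c

Move² : Set
Move² = Move × Move

reverse² : Move² → Move²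
reverse² (mx , my) = reverse mx , reverse my

infix 4 _∈₂_
_∈₂_ : {A : Set} → A → A × A → Set
a ∈₂ (b , c) = a ≡ b ⊎ a ≡ c

-- The two moves chosen at a cell whose coordinates have the given views
-- (found by computer search; only admissible windows matter).
rule : View → View → Move² × Move²
rule (false , true , true , true , true) (false , true , true , true , true) = (B₀ , B₁) , (F₀ , B₁)
rule (false , true , true , true , true) (false , true , true , true , false) = (B₀ , B₁) , (F₀ , B₁)
rule (false , true , true , true , true) (false , true , true , false , true) = (B₀ , B₁) , (B₀ , F₀)
rule (false , true , true , true , true) (false , true , false , true , true) = (B₁ , F₀) , (F₀ , B₀)
rule (false , true , true , true , true) (false , true , false , true , false) = (B₁ , F₀) , (F₀ , B₀)
rule (false , true , true , true , true) (false , false , true , true , true) = (B₁ , B₀) , (F₀ , B₁)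
rule (false , true , true , true , true) (false , false , true , true , false) = (B₁ , B₀) , (F₀ , B₁)
rule (false , true , true , true , true) (false , false , true , false , true) = (B₀ , F₀) , (B₁ , B₀)
rule (false , true , true , true , true) (true , true , true , true , true) = (B₀ , F₁) , (F₀ , F₁)
rule (false , true , true , true , true) (true , true , true , true , false) = (B₁ , F₀) , (F₀ , F₁)
rule (false , true , true , true , true) (true , true , true , false , true) = (B₁ , B₀) , (F₀ , F₀)
rule (false , true , true , true , true) (true , true , false , true , true) = (B₀ , B₀) , (B₀ , F₁)
rule (false , true , true , true , true) (true , true , false , true , false) = (B₀ , B₀) , (B₁ , F₀)
rule (false , true , true , true , true) (true , false , true , true , true) = (B₀ , F₁) , (F₀ , F₁)
rule (false , true , true , true , true) (true , false , true , true , false) = (B₁ , F₀) , (F₀ , F₁)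
rule (false , true , true , true , true) (true , false , true , false , true) = (B₁ , B₀) , (F₀ , F₀)
rule (false , true , true , true , false) (false , true , true , true , true) = (B₀ , B₁) , (F₀ , B₁)
rule (false , true , true , true , false) (false , true , true , true , false) = (B₀ , B₁) , (F₀ , B₁)
rule (false , true , true , true , false) (false , true , true , false , true) = (B₀ , B₁) , (B₀ , F₀)
rule (false , true , true , true , false) (false , true , false , true , true) = (B₁ , F₀) , (F₀ , B₀)
rule (false , true , true , true , false) (false , true , false , true , false) = (B₁ , F₀) , (F₀ , B₀)
rule (false , true , true , true , false) (false , false , true , true , true) = (B₁ , B₀) , (F₀ , B₁)
rule (false , true , true , true , false) (false , false , true , true , false) = (B₁ , B₀) , (F₀ , B₁)
rule (false , true , true , true , false) (false , false , true , false , true) = (B₀ , F₀) , (B₁ , B₀)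
rule (false , true , true , true , false) (true , true , true , true , true) = (B₀ , F₁) , (F₀ , F₁)
rule (false , true , true , true , false) (true , true , true , true , false) = (B₁ , F₀) , (F₀ , F₁)
rule (false , true , true , true , false) (true , true , true , false , true) = (B₁ , B₀) , (F₀ , F₀)
rule (false , true , true , true , false) (true , true , false , true , true) = (B₀ , B₀) , (B₀ , F₁)
rule (false , true , true , true , false) (true , true , false , true , false) = (B₀ , B₀) , (B₁ , F₀)
rule (false , true , true , true , false) (true , false , true , true , true) = (B₀ , F₁) , (F₀ , F₁)
rule (false , true , true , true , false) (true , false , true , true , false) = (B₁ , F₀) , (F₀ , F₁)
rule (false , true , true , true , false) (true , false , true , false , true) = (B₁ , B₀) , (F₀ , F₀)
rule (false , true , true , false , true) (false , true , true , true , true) = (B₀ , B₁) , (F₀ , F₀)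
rule (false , true , true , false , true) (false , true , true , true , false) = (B₀ , B₁) , (F₀ , F₀)
rule (false , true , true , false , true) (false , true , true , false , true) = (B₀ , B₁) , (B₀ , F₀)
rule (false , true , true , false , true) (false , true , false , true , true) = (B₁ , F₀) , (F₀ , F₀)
rule (false , true , true , false , true) (false , true , false , true , false) = (B₁ , F₀) , (F₀ , F₀)
rule (false , true , true , false , true) (false , false , true , true , true) = (F₀ , B₀) , (F₀ , F₀)
rule (false , true , true , false , true) (false , false , true , true , false) = (F₀ , B₀) , (F₀ , F₀)
rule (false , true , true , false , true) (false , false , true , false , true) = (B₀ , F₀) , (F₀ , B₀)
rule (false , true , true , false , true) (true , true , true , true , true) = (B₀ , F₁) , (F₀ , B₀)
rule (false , true , true , false , true) (true , true , true , true , false) = (F₀ , B₀) , (F₀ , F₀)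
rule (false , true , true , false , true) (true , true , true , false , true) = (B₁ , B₀) , (F₀ , B₀)
rule (false , true , true , false , true) (true , true , false , true , true) = (B₀ , B₀) , (B₀ , F₁)
rule (false , true , true , false , true) (true , true , false , true , false) = (B₀ , B₀) , (F₀ , F₀)
rule (false , true , true , false , true) (true , false , true , true , true) = (B₀ , F₁) , (F₀ , B₀)
rule (false , true , true , false , true) (true , false , true , true , false) = (F₀ , B₀) , (F₀ , F₀)
rule (false , true , true , false , true) (true , false , true , false , true) = (B₁ , B₀) , (F₀ , B₀)
rule (false , true , false , true , true) (false , true , true , true , true) = (B₀ , B₀) , (F₀ , B₁)
rule (false , true , false , true , true) (false , true , true , true , false) = (B₀ , B₀) , (F₀ , B₁)
rule (false , true , false , true , true) (false , true , true , false , true) = (B₀ , B₀) , (F₀ , F₀)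
rule (false , true , false , true , true) (false , true , false , true , true) = (B₀ , F₀) , (F₀ , B₀)
rule (false , true , false , true , true) (false , true , false , true , false) = (B₀ , F₀) , (F₀ , B₀)
rule (false , true , false , true , true) (false , false , true , true , true) = (B₀ , B₀) , (F₀ , B₁)
rule (false , true , false , true , true) (false , false , true , true , false) = (B₀ , B₀) , (F₀ , B₁)
rule (false , true , false , true , true) (false , false , true , false , true) = (B₀ , B₀) , (F₀ , F₀)
rule (false , true , false , true , true) (true , true , true , true , true) = (B₀ , F₀) , (F₀ , F₁)
rule (false , true , false , true , true) (true , true , true , true , false) = (B₀ , F₀) , (F₀ , F₁)
rule (false , true , false , true , true) (true , true , true , false , true) = (B₀ , B₀) , (F₀ , F₀)
rule (false , true , false , true , true) (true , true , false , true , true) = (B₀ , F₀) , (F₀ , B₀)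
rule (false , true , false , true , true) (true , true , false , true , false) = (B₀ , F₀) , (F₀ , B₀)
rule (false , true , false , true , true) (true , false , true , true , true) = (B₀ , F₀) , (F₀ , F₁)
rule (false , true , false , true , true) (true , false , true , true , false) = (B₀ , F₀) , (F₀ , F₁)
rule (false , true , false , true , true) (true , false , true , false , true) = (B₀ , B₀) , (F₀ , F₀)
rule (false , true , false , true , false) (false , true , true , true , true) = (B₀ , B₀) , (F₀ , B₁)
rule (false , true , false , true , false) (false , true , true , true , false) = (B₀ , B₀) , (F₀ , B₁)
rule (false , true , false , true , false) (false , true , true , false , true) = (B₀ , B₀) , (F₀ , F₀)
rule (false , true , false , true , false) (false , true , false , true , true) = (B₀ , F₀) , (F₀ , B₀)
rule (false , true , false , true , false) (false , true , false , true , false) = (B₀ , F₀) , (F₀ , B₀)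
rule (false , true , false , true , false) (false , false , true , true , true) = (B₀ , B₀) , (F₀ , B₁)
rule (false , true , false , true , false) (false , false , true , true , false) = (B₀ , B₀) , (F₀ , B₁)
rule (false , true , false , true , false) (false , false , true , false , true) = (B₀ , B₀) , (F₀ , F₀)
rule (false , true , false , true , false) (true , true , true , true , true) = (B₀ , F₀) , (F₀ , F₁)
rule (false , true , false , true , false) (true , true , true , true , false) = (B₀ , F₀) , (F₀ , F₁)
rule (false , true , false , true , false) (true , true , true , false , true) = (B₀ , B₀) , (F₀ , F₀)
rule (false , true , false , true , false) (true , true , false , true , true) = (B₀ , F₀) , (F₀ , B₀)
rule (false , true , false , true , false) (true , true , false , true , false) = (B₀ , F₀) , (F₀ , B₀)
rule (false , true , false , true , false) (true , false , true , true , true) = (B₀ , F₀) , (F₀ , F₁)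
rule (false , true , false , true , false) (true , false , true , true , false) = (B₀ , F₀) , (F₀ , F₁)
rule (false , true , false , true , false) (true , false , true , false , true) = (B₀ , B₀) , (F₀ , F₀)
rule (false , false , true , true , true) (false , true , true , true , true) = (B₀ , B₁) , (F₀ , B₁)
rule (false , false , true , true , true) (false , true , true , true , false) = (B₀ , B₁) , (F₀ , B₁)
rule (false , false , true , true , true) (false , true , true , false , true) = (B₀ , B₁) , (B₀ , F₀)
rule (false , false , true , true , true) (false , true , false , true , true) = (B₀ , B₀) , (F₀ , B₀)
rule (false , false , true , true , true) (false , true , false , true , false) = (B₀ , B₀) , (F₀ , B₀)
rule (false , false , true , true , true) (false , false , true , true , true) = (B₁ , B₀) , (F₀ , B₁)
rule (false , false , true , true , true) (false , false , true , true , false) = (B₁ , B₀) , (F₀ , B₁)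
rule (false , false , true , true , true) (false , false , true , false , true) = (B₀ , F₀) , (B₁ , B₀)
rule (false , false , true , true , true) (true , true , true , true , true) = (B₀ , F₁) , (F₀ , F₁)
rule (false , false , true , true , true) (true , true , true , true , false) = (B₁ , F₀) , (F₀ , F₁)
rule (false , false , true , true , true) (true , true , true , false , true) = (B₀ , F₀) , (F₀ , F₀)
rule (false , false , true , true , true) (true , true , false , true , true) = (B₀ , B₀) , (B₀ , F₁)
rule (false , false , true , true , true) (true , true , false , true , false) = (B₀ , B₀) , (B₁ , F₀)
rule (false , false , true , true , true) (true , false , true , true , true) = (B₀ , F₁) , (F₀ , F₁)
rule (false , false , true , true , true) (true , false , true , true , false) = (B₁ , F₀) , (F₀ , F₁)
rule (false , false , true , true , true) (true , false , true , false , true) = (B₀ , F₀) , (F₀ , F₀)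
rule (false , false , true , true , false) (false , true , true , true , true) = (B₀ , B₁) , (F₀ , B₁)
rule (false , false , true , true , false) (false , true , true , true , false) = (B₀ , B₁) , (F₀ , B₁)
rule (false , false , true , true , false) (false , true , true , false , true) = (B₀ , B₁) , (B₀ , F₀)
rule (false , false , true , true , false) (false , true , false , true , true) = (B₀ , B₀) , (F₀ , B₀)
rule (false , false , true , true , false) (false , true , false , true , false) = (B₀ , B₀) , (F₀ , B₀)
rule (false , false , true , true , false) (false , false , true , true , true) = (B₁ , B₀) , (F₀ , B₁)
rule (false , false , true , true , false) (false , false , true , true , false) = (B₁ , B₀) , (F₀ , B₁)
rule (false , false , true , true , false) (false , false , true , false , true) = (B₀ , F₀) , (B₁ , B₀)
rule (false , false , true , true , false) (true , true , true , true , true) = (B₀ , F₁) , (F₀ , F₁)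
rule (false , false , true , true , false) (true , true , true , true , false) = (B₁ , F₀) , (F₀ , F₁)
rule (false , false , true , true , false) (true , true , true , false , true) = (B₀ , F₀) , (F₀ , F₀)
rule (false , false , true , true , false) (true , true , false , true , true) = (B₀ , B₀) , (B₀ , F₁)
rule (false , false , true , true , false) (true , true , false , true , false) = (B₀ , B₀) , (B₁ , F₀)
rule (false , false , true , true , false) (true , false , true , true , true) = (B₀ , F₁) , (F₀ , F₁)
rule (false , false , true , true , false) (true , false , true , true , false) = (B₁ , F₀) , (F₀ , F₁)
rule (false , false , true , true , false) (true , false , true , false , true) = (B₀ , F₀) , (F₀ , F₀)
rule (false , false , true , false , true) (false , true , true , true , true) = (B₀ , B₁) , (F₀ , F₀)
rule (false , false , true , false , true) (false , true , true , true , false) = (B₀ , B₁) , (F₀ , F₀)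
rule (false , false , true , false , true) (false , true , true , false , true) = (B₀ , B₁) , (B₀ , F₀)
rule (false , false , true , false , true) (false , true , false , true , true) = (B₀ , B₀) , (F₀ , F₀)
rule (false , false , true , false , true) (false , true , false , true , false) = (B₀ , B₀) , (F₀ , F₀)
rule (false , false , true , false , true) (false , false , true , true , true) = (F₀ , B₀) , (F₀ , F₀)
rule (false , false , true , false , true) (false , false , true , true , false) = (F₀ , B₀) , (F₀ , F₀)
rule (false , false , true , false , true) (false , false , true , false , true) = (B₀ , F₀) , (F₀ , B₀)
rule (false , false , true , false , true) (true , true , true , true , true) = (B₀ , F₁) , (F₀ , B₀)
rule (false , false , true , false , true) (true , true , true , true , false) = (F₀ , B₀) , (F₀ , F₀)
rule (false , false , true , false , true) (true , true , true , false , true) = (B₀ , F₀) , (F₀ , B₀)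
rule (false , false , true , false , true) (true , true , false , true , true) = (B₀ , B₀) , (B₀ , F₁)
rule (false , false , true , false , true) (true , true , false , true , false) = (B₀ , B₀) , (F₀ , F₀)
rule (false , false , true , false , true) (true , false , true , true , true) = (B₀ , F₁) , (F₀ , B₀)
rule (false , false , true , false , true) (true , false , true , true , false) = (F₀ , B₀) , (F₀ , F₀)
rule (false , false , true , false , true) (true , false , true , false , true) = (B₀ , F₀) , (F₀ , B₀)
rule (true , true , true , true , true) (false , true , true , true , true) = (B₀ , B₁) , (F₀ , B₁)
rule (true , true , true , true , true) (false , true , true , true , false) = (B₀ , B₁) , (F₀ , B₁)
rule (true , true , true , true , true) (false , true , true , false , true) = (B₀ , B₁) , (F₀ , F₀)
rule (true , true , true , true , true) (false , true , false , true , true) = (B₀ , B₀) , (F₁ , F₀)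
rule (true , true , true , true , true) (false , true , false , true , false) = (B₀ , B₀) , (F₁ , F₀)
rule (true , true , true , true , true) (false , false , true , true , true) = (F₀ , B₁) , (F₁ , B₀)
rule (true , true , true , true , true) (false , false , true , true , false) = (F₀ , B₁) , (F₁ , B₀)
rule (true , true , true , true , true) (false , false , true , false , true) = (F₀ , F₀) , (F₁ , B₀)
rule (true , true , true , true , true) (true , true , true , true , true) = (B₀ , F₁) , (F₀ , F₁)
rule (true , true , true , true , true) (true , true , true , true , false) = (F₀ , F₁) , (F₁ , F₀)
rule (true , true , true , true , true) (true , true , true , false , true) = (B₀ , F₀) , (F₁ , B₀)
rule (true , true , true , true , true) (true , true , false , true , true) = (B₀ , F₁) , (F₀ , B₀)
rule (true , true , true , true , true) (true , true , false , true , false) = (F₀ , B₀) , (F₁ , F₀)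
rule (true , true , true , true , true) (true , false , true , true , true) = (B₀ , F₁) , (F₀ , F₁)
rule (true , true , true , true , true) (true , false , true , true , false) = (F₀ , F₁) , (F₁ , F₀)
rule (true , true , true , true , true) (true , false , true , false , true) = (B₀ , F₀) , (F₁ , B₀)
rule (true , true , true , true , false) (false , true , true , true , true) = (B₀ , B₁) , (F₀ , B₁)
rule (true , true , true , true , false) (false , true , true , true , false) = (B₀ , B₁) , (F₀ , B₁)
rule (true , true , true , true , false) (false , true , true , false , true) = (B₀ , B₁) , (F₀ , F₀)
rule (true , true , true , true , false) (false , true , false , true , true) = (B₀ , B₀) , (F₀ , B₀)
rule (true , true , true , true , false) (false , true , false , true , false) = (B₀ , B₀) , (F₀ , B₀)
rule (true , true , true , true , false) (false , false , true , true , true) = (F₀ , B₁) , (F₁ , B₀)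
rule (true , true , true , true , false) (false , false , true , true , false) = (F₀ , B₁) , (F₁ , B₀)
rule (true , true , true , true , false) (false , false , true , false , true) = (F₀ , F₀) , (F₁ , B₀)
rule (true , true , true , true , false) (true , true , true , true , true) = (B₀ , F₁) , (F₀ , F₁)
rule (true , true , true , true , false) (true , true , true , true , false) = (F₀ , F₁) , (F₁ , F₀)
rule (true , true , true , true , false) (true , true , true , false , true) = (B₀ , F₀) , (F₀ , F₀)
rule (true , true , true , true , false) (true , true , false , true , true) = (B₀ , F₁) , (F₀ , B₀)
rule (true , true , true , true , false) (true , true , false , true , false) = (F₀ , B₀) , (F₁ , F₀)
rule (true , true , true , true , false) (true , false , true , true , true) = (B₀ , F₁) , (F₀ , F₁)
rule (true , true , true , true , false) (true , false , true , true , false) = (F₀ , F₁) , (F₁ , F₀)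
rule (true , true , true , true , false) (true , false , true , false , true) = (B₀ , F₀) , (F₀ , F₀)
rule (true , true , true , false , true) (false , true , true , true , true) = (B₀ , B₁) , (F₀ , F₀)
rule (true , true , true , false , true) (false , true , true , true , false) = (B₀ , B₁) , (F₀ , F₀)
rule (true , true , true , false , true) (false , true , true , false , true) = (B₀ , B₁) , (B₀ , F₀)
rule (true , true , true , false , true) (false , true , false , true , true) = (B₀ , B₀) , (F₀ , F₀)
rule (true , true , true , false , true) (false , true , false , true , false) = (B₀ , B₀) , (F₀ , F₀)
rule (true , true , true , false , true) (false , false , true , true , true) = (F₀ , B₀) , (F₀ , F₀)
rule (true , true , true , false , true) (false , false , true , true , false) = (F₀ , B₀) , (F₀ , F₀)
rule (true , true , true , false , true) (false , false , true , false , true) = (B₀ , F₀) , (F₀ , B₀)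
rule (true , true , true , false , true) (true , true , true , true , true) = (B₀ , F₁) , (F₀ , B₀)
rule (true , true , true , false , true) (true , true , true , true , false) = (F₀ , B₀) , (F₀ , F₀)
rule (true , true , true , false , true) (true , true , true , false , true) = (B₀ , F₀) , (F₀ , B₀)
rule (true , true , true , false , true) (true , true , false , true , true) = (B₀ , B₀) , (B₀ , F₁)
rule (true , true , true , false , true) (true , true , false , true , false) = (B₀ , B₀) , (F₀ , F₀)
rule (true , true , true , false , true) (true , false , true , true , true) = (B₀ , F₁) , (F₀ , B₀)
rule (true , true , true , false , true) (true , false , true , true , false) = (F₀ , B₀) , (F₀ , F₀)
rule (true , true , true , false , true) (true , false , true , false , true) = (B₀ , F₀) , (F₀ , B₀)
rule (true , true , false , true , true) (false , true , true , true , true) = (B₀ , B₀) , (F₀ , B₁)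
rule (true , true , false , true , true) (false , true , true , true , false) = (B₀ , B₀) , (F₀ , B₁)
rule (true , true , false , true , true) (false , true , true , false , true) = (B₀ , B₀) , (F₀ , F₀)
rule (true , true , false , true , true) (false , true , false , true , true) = (B₀ , F₀) , (F₁ , F₀)
rule (true , true , false , true , true) (false , true , false , true , false) = (B₀ , F₀) , (F₁ , F₀)
rule (true , true , false , true , true) (false , false , true , true , true) = (B₀ , B₀) , (F₀ , B₁)
rule (true , true , false , true , true) (false , false , true , true , false) = (B₀ , B₀) , (F₀ , B₁)
rule (true , true , false , true , true) (false , false , true , false , true) = (B₀ , B₀) , (F₀ , F₀)
rule (true , true , false , true , true) (true , true , true , true , true) = (B₀ , F₀) , (F₀ , F₁)
rule (true , true , false , true , true) (true , true , true , true , false) = (B₀ , F₀) , (F₀ , F₁)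
rule (true , true , false , true , true) (true , true , true , false , true) = (B₀ , B₀) , (F₁ , B₀)
rule (true , true , false , true , true) (true , true , false , true , true) = (B₀ , F₀) , (F₀ , B₀)
rule (true , true , false , true , true) (true , true , false , true , false) = (B₀ , F₀) , (F₀ , B₀)
rule (true , true , false , true , true) (true , false , true , true , true) = (B₀ , F₀) , (F₀ , F₁)
rule (true , true , false , true , true) (true , false , true , true , false) = (B₀ , F₀) , (F₀ , F₁)
rule (true , true , false , true , true) (true , false , true , false , true) = (B₀ , B₀) , (F₁ , B₀)
rule (true , true , false , true , false) (false , true , true , true , true) = (B₀ , B₀) , (F₀ , B₁)
rule (true , true , false , true , false) (false , true , true , true , false) = (B₀ , B₀) , (F₀ , B₁)
rule (true , true , false , true , false) (false , true , true , false , true) = (B₀ , B₀) , (F₀ , F₀)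
rule (true , true , false , true , false) (false , true , false , true , true) = (B₀ , F₀) , (F₀ , B₀)
rule (true , true , false , true , false) (false , true , false , true , false) = (B₀ , F₀) , (F₀ , B₀)
rule (true , true , false , true , false) (false , false , true , true , true) = (B₀ , B₀) , (F₀ , B₁)
rule (true , true , false , true , false) (false , false , true , true , false) = (B₀ , B₀) , (F₀ , B₁)
rule (true , true , false , true , false) (false , false , true , false , true) = (B₀ , B₀) , (F₀ , F₀)
rule (true , true , false , true , false) (true , true , true , true , true) = (B₀ , F₀) , (F₀ , F₁)
rule (true , true , false , true , false) (true , true , true , true , false) = (B₀ , F₀) , (F₀ , F₁)
rule (true , true , false , true , false) (true , true , true , false , true) = (B₀ , B₀) , (F₀ , F₀)
rule (true , true , false , true , false) (true , true , false , true , true) = (B₀ , F₀) , (F₀ , B₀)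
rule (true , true , false , true , false) (true , true , false , true , false) = (B₀ , F₀) , (F₀ , B₀)
rule (true , true , false , true , false) (true , false , true , true , true) = (B₀ , F₀) , (F₀ , F₁)
rule (true , true , false , true , false) (true , false , true , true , false) = (B₀ , F₀) , (F₀ , F₁)
rule (true , true , false , true , false) (true , false , true , false , true) = (B₀ , B₀) , (F₀ , F₀)
rule (true , false , true , true , true) (false , true , true , true , true) = (B₀ , B₁) , (F₀ , B₁)
rule (true , false , true , true , true) (false , true , true , true , false) = (B₀ , B₁) , (F₀ , B₁)
rule (true , false , true , true , true) (false , true , true , false , true) = (B₀ , B₁) , (F₀ , F₀)
rule (true , false , true , true , true) (false , true , false , true , true) = (B₀ , B₀) , (F₁ , F₀)
rule (true , false , true , true , true) (false , true , false , true , false) = (B₀ , B₀) , (F₁ , F₀)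
rule (true , false , true , true , true) (false , false , true , true , true) = (F₀ , B₁) , (F₁ , B₀)
rule (true , false , true , true , true) (false , false , true , true , false) = (F₀ , B₁) , (F₁ , B₀)
rule (true , false , true , true , true) (false , false , true , false , true) = (F₀ , F₀) , (F₁ , B₀)
rule (true , false , true , true , true) (true , true , true , true , true) = (B₀ , F₁) , (F₀ , F₁)
rule (true , false , true , true , true) (true , true , true , true , false) = (F₀ , F₁) , (F₁ , F₀)
rule (true , false , true , true , true) (true , true , true , false , true) = (B₀ , F₀) , (F₁ , B₀)
rule (true , false , true , true , true) (true , true , false , true , true) = (B₀ , F₁) , (F₀ , B₀)
rule (true , false , true , true , true) (true , true , false , true , false) = (F₀ , B₀) , (F₁ , F₀)
rule (true , false , true , true , true) (true , false , true , true , true) = (B₀ , F₁) , (F₀ , F₁)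
rule (true , false , true , true , true) (true , false , true , true , false) = (F₀ , F₁) , (F₁ , F₀)
rule (true , false , true , true , true) (true , false , true , false , true) = (B₀ , F₀) , (F₁ , B₀)
rule (true , false , true , true , false) (false , true , true , true , true) = (B₀ , B₁) , (F₀ , B₁)
rule (true , false , true , true , false) (false , true , true , true , false) = (B₀ , B₁) , (F₀ , B₁)
rule (true , false , true , true , false) (false , true , true , false , true) = (B₀ , B₁) , (F₀ , F₀)
rule (true , false , true , true , false) (false , true , false , true , true) = (B₀ , B₀) , (F₀ , B₀)
rule (true , false , true , true , false) (false , true , false , true , false) = (B₀ , B₀) , (F₀ , B₀)
rule (true , false , true , true , false) (false , false , true , true , true) = (F₀ , B₁) , (F₁ , B₀)
rule (true , false , true , true , false) (false , false , true , true , false) = (F₀ , B₁) , (F₁ , B₀)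
rule (true , false , true , true , false) (false , false , true , false , true) = (F₀ , F₀) , (F₁ , B₀)
rule (true , false , true , true , false) (true , true , true , true , true) = (B₀ , F₁) , (F₀ , F₁)
rule (true , false , true , true , false) (true , true , true , true , false) = (F₀ , F₁) , (F₁ , F₀)
rule (true , false , true , true , false) (true , true , true , false , true) = (B₀ , F₀) , (F₀ , F₀)
rule (true , false , true , true , false) (true , true , false , true , true) = (B₀ , F₁) , (F₀ , B₀)
rule (true , false , true , true , false) (true , true , false , true , false) = (F₀ , B₀) , (F₁ , F₀)
rule (true , false , true , true , false) (true , false , true , true , true) = (B₀ , F₁) , (F₀ , F₁)
rule (true , false , true , true , false) (true , false , true , true , false) = (F₀ , F₁) , (F₁ , F₀)
rule (true , false , true , true , false) (true , false , true , false , true) = (B₀ , F₀) , (F₀ , F₀)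
rule (true , false , true , false , true) (false , true , true , true , true) = (B₀ , B₁) , (F₀ , F₀)
rule (true , false , true , false , true) (false , true , true , true , false) = (B₀ , B₁) , (F₀ , F₀)
rule (true , false , true , false , true) (false , true , true , false , true) = (B₀ , B₁) , (B₀ , F₀)
rule (true , false , true , false , true) (false , true , false , true , true) = (B₀ , B₀) , (F₀ , F₀)
rule (true , false , true , false , true) (false , true , false , true , false) = (B₀ , B₀) , (F₀ , F₀)
rule (true , false , true , false , true) (false , false , true , true , true) = (F₀ , B₀) , (F₀ , F₀)
rule (true , false , true , false , true) (false , false , true , true , false) = (F₀ , B₀) , (F₀ , F₀)
rule (true , false , true , false , true) (false , false , true , false , true) = (B₀ , F₀) , (F₀ , B₀)
rule (true , false , true , false , true) (true , true , true , true , true) = (B₀ , F₁) , (F₀ , B₀)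
rule (true , false , true , false , true) (true , true , true , true , false) = (F₀ , B₀) , (F₀ , F₀)
rule (true , false , true , false , true) (true , true , true , false , true) = (B₀ , F₀) , (F₀ , B₀)
rule (true , false , true , false , true) (true , true , false , true , true) = (B₀ , B₀) , (B₀ , F₁)
rule (true , false , true , false , true) (true , true , false , true , false) = (B₀ , B₀) , (F₀ , F₀)
rule (true , false , true , false , true) (true , false , true , true , true) = (B₀ , F₁) , (F₀ , B₀)
rule (true , false , true , false , true) (true , false , true , true , false) = (F₀ , B₀) , (F₀ , F₀)
rule (true , false , true , false , true) (true , false , true , false , true) = (B₀ , F₀) , (F₀ , B₀)
rule _ _ = (F₀ , F₀) , (F₀ , F₀)

GoodMove : View → View → Move² → Set
GoodMove vx vy m =
  Valid (proj₁ m) vx × Valid (proj₂ m) vy ×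
  stepType (proj₂ m) (proj₂ vy) ≡ not (stepType (proj₁ m) (proj₂ vx)) ×
  (∀ nx ny → Admissible (shift (proj₁ m) (proj₂ vx) nx) → Admissible (shift (proj₂ m) (proj₂ vy) ny) →
     reverse² m ∈₂ rule (after (proj₁ m) vx nx) (after (proj₂ m) vy ny))

LocallyGood : View → View → Set
LocallyGood vx vy =
  proj₁ (rule vx vy) ≢ proj₂ (rule vx vy) ×
  GoodMove vx vy (proj₁ (rule vx vy)) × GoodMove vx vy (proj₂ (rule vx vy))

_≟ᴹ_ : DecidableEquality Move²
_≟ᴹ_ = ≡-dec (≡-dec _≟ᵇ_ _≟ᵇ_) (≡-dec _≟ᵇ_ _≟ᵇ_)

∀Bool? : {P : Bool → Set} → (∀ b → Dec (P b)) → Dec (∀ b → P b)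
∀Bool? P? = map′ (λ { (t , f) true → t ; (t , f) false → f }) (λ h → h true , h false)
                 (P? true ×-dec P? false)

∀View? : {P : View → Set} → (∀ v → Dec (P v)) → Dec (∀ v → P v)
∀View? P? = map′ (λ h (x , a , b , c , d) → h x a b c d) (λ h x a b c d → h (x , a , b , c , d))
  (∀Bool? λ x → ∀Bool? λ a → ∀Bool? λ b → ∀Bool? λ c → ∀Bool? λ d → P? (x , a , b , c , d))

Admissible? : ∀ w → Dec (Admissible w)
Admissible? (a , b , c , d) = T? _

Valid? : ∀ m v → Dec (Valid m v)
Valid? (_     , false) _       = yes tt
Valid? (true  , true)  (h , w) = h ≟ᵇ current w
Valid? (false , true)  (h , w) = h ≟ᵇ not (previous w)

∈₂? : ∀ m (r : Move² × Move²) → Dec (m ∈₂ r)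
∈₂? m (a , b) = (m ≟ᴹ a) ⊎-dec (m ≟ᴹ b)

GoodMove? : ∀ vx vy m → Dec (GoodMove vx vy m)
GoodMove? vx vy (mx , my) =
  Valid? mx vx ×-dec Valid? my vy ×-dec
  (stepType my (proj₂ vy) ≟ᵇ not (stepType mx (proj₂ vx))) ×-dec
  ∀Bool? λ nx → ∀Bool? λ ny →
    Admissible? (shift mx (proj₂ vx) nx) →-dec Admissible? (shift my (proj₂ vy) ny) →-dec
    ∈₂? (reverse² (mx , my)) (rule (after mx vx nx) (after my vy ny))

LocallyGood? : ∀ vx vy → Dec (LocallyGood vx vy)
LocallyGood? vx vy = ¬? (proj₁ (rule vx vy) ≟ᴹ proj₂ (rule vx vy)) ×-dec
  GoodMove? vx vy (proj₁ (rule vx vy)) ×-dec GoodMove? vx vy (proj₂ (rule vx vy))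

rule-locallyGood : ∀ vx vy → Admissible (proj₂ vx) → Admissible (proj₂ vy) → LocallyGood vx vy
rule-locallyGood = toWitness {a? = ∀View? λ vx → ∀View? λ vy →
  Admissible? (proj₂ vx) →-dec Admissible? (proj₂ vy) →-dec LocallyGood? vx vy} tt

record LocalCoordinates (X : Set) : Set₁ where
  field
    Step           : X → X → Bool → Set
    Step-sym       : ∀ {x y t} → Step x y t → Step y x t
    view           : X → View
    move           : Move → X → X
    admissible     : ∀ x → Admissible (proj₂ (view x))
    view-move      : ∀ m x → ∃[ n ] view (move m x) ≡ after m (view x) n
    move-reverse   : ∀ m x → move (reverse m) (move m x) ≡ x
    move-injective : ∀ x {m m′} → move m x ≡ move m′ x → m ≡ m′
    forward-step   : ∀ c x → Valid (true , c) (view x) →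
                     Step x (move (true , c) x) (stepType (true , c) (proj₂ (view x)))

  -- A valid backward move is the reverse of a valid forward move with the same length.
  backward-valid : ∀ c v n → Valid (false , c) v → Valid (true , c) (after (false , c) v n)
  backward-valid false v n _ = tt
  backward-valid true (true , _ , false , _ , _) n refl = refl
  backward-valid true (false , _ , true , _ , _) n refl = refl

  backward-type : ∀ c w n → stepType (true , c) (shift (false , c) w n) ≡ stepType (false , c) w
  backward-type c (a , b , e , f) n = refl

  move-step : ∀ m x → Valid m (view x) → Step x (move m x) (stepType m (proj₂ (view x)))
  move-step (true , c) x valid = forward-step c x valid
  move-step (false , c) x valid with view-move (false , c) x
  ... | n , eq = Step-sym (subst₂ (Step y) (move-reverse (false , c) x) type step)
    where
    y = move (false , c) x
    step : Step y (move (true , c) y) (stepType (true , c) (proj₂ (view y)))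
    step = forward-step c y (subst (Valid (true , c)) (sym eq) (backward-valid c (view x) n valid))
    type : stepType (true , c) (proj₂ (view y)) ≡ stepType (false , c) (proj₂ (view x))
    type = trans (cong (λ v → stepType (true , c) (proj₂ v)) eq) (backward-type c (proj₂ (view x)) n)

module RuleTwoFactor {X : Set} (C : LocalCoordinates X) where
  open LocalCoordinates C

  Point : Set
  Point = X × X

  Adjacent : Point → Point → Set
  Adjacent (x , y) (x′ , y′) = ∃[ t ] Step x x′ t × Step y y′ (not t)

  choice : Point → Move² × Move²
  choice (x , y) = rule (view x) (view y)

  move² : Move² → Point → Point
  move² (mx , my) (x , y) = move mx x , move my y

  move²-reverse : ∀ m v → move² (reverse² m) (move² m v) ≡ v
  move²-reverse (mx , my) (x , y) = cong₂ _,_ (move-reverse mx x) (move-reverse my y)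

  move²-injective : ∀ v {m m′} → move² m v ≡ move² m′ v → m ≡ m′
  move²-injective (x , y) eq = cong₂ _,_ (move-injective x (cong proj₁ eq)) (move-injective y (cong proj₂ eq))

  Edge : Point → Point → Set
  Edge v w = w ≡ move² (proj₁ (choice v)) v ⊎ w ≡ move² (proj₂ (choice v)) v

  edge-from-choice : ∀ v m → m ∈₂ choice v → Edge v (move² m v)
  edge-from-choice v m (inj₁ refl) = inj₁ refl
  edge-from-choice v m (inj₂ refl) = inj₂ refl

  choice-good : ∀ v → LocallyGood (view (proj₁ v)) (view (proj₂ v))
  choice-good (x , y) = rule-locallyGood (view x) (view y) (admissible x) (admissible y)

  chosen-good : ∀ v m → m ∈₂ choice v → GoodMove (view (proj₁ v)) (view (proj₂ v)) m
  chosen-good v m (inj₁ refl) = proj₁ (proj₂ (choice-good v))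
  chosen-good v m (inj₂ refl) = proj₂ (proj₂ (choice-good v))

  chosen-adjacent : ∀ v m → GoodMove (view (proj₁ v)) (view (proj₂ v)) m → Adjacent v (move² m v)
  chosen-adjacent (x , y) (mx , my) (valid-x , valid-y , types , _) =
    stepType mx (proj₂ (view x)) , move-step mx x valid-x ,
    subst (Step y (move my y)) types (move-step my y valid-y)

  -- The target's views are among those the check quantified over, so the reverse
  -- move is chosen there.
  chosen-back : ∀ v m → GoodMove (view (proj₁ v)) (view (proj₂ v)) m → reverse² m ∈₂ choice (move² m v)
  chosen-back (x , y) (mx , my) (_ , _ , _ , back)
    with view-move mx x | view-move my y
  ... | nx , eqx | ny , eqy =
    subst₂ (λ vx′ vy′ → reverse² (mx , my) ∈₂ rule vx′ vy′) (sym eqx) (sym eqy)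
      (back nx ny (subst (λ v → Admissible (proj₂ v)) eqx (admissible (move mx x)))
                  (subst (λ v → Admissible (proj₂ v)) eqy (admissible (move my y))))

  edge-back : ∀ v m → m ∈₂ choice v → Edge (move² m v) v
  edge-back v m m∈ = subst (Edge (move² m v)) (move²-reverse m v)
    (edge-from-choice (move² m v) (reverse² m) (chosen-back v m (chosen-good v m m∈)))

  Edge-adjacent : ∀ v w → Edge v w → Adjacent v w
  Edge-adjacent v w (inj₁ refl) = chosen-adjacent v _ (chosen-good v _ (inj₁ refl))
  Edge-adjacent v w (inj₂ refl) = chosen-adjacent v _ (chosen-good v _ (inj₂ refl))

  Edge-sym : ∀ v w → Edge v w → Edge w v
  Edge-sym v w (inj₁ refl) = edge-back v _ (inj₁ refl)
  Edge-sym v w (inj₂ refl) = edge-back v _ (inj₂ refl)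

  twoFactor : TwoFactor Adjacent
  twoFactor = Edge , Edge-adjacent , Edge-sym ,
    λ v → move² (proj₁ (choice v)) v , move² (proj₂ (choice v)) v ,
          (λ eq → proj₁ (choice-good v) (move²-injective v eq)) , inj₁ refl , inj₂ refl , λ w e → e

-- Positions 0 ≤ u < s = p + q with the rotation u ↦ u + p (mod s) and its inverse
-- u ↦ u + q (mod s); a position is labelled true when it is low, u < q.
module Rotation (p q : ℕ) where

  s : ℕ
  s = p + q

  label : ℕ → Bool
  label u with u <? q
  ... | yes _ = true
  ... | no  _ = false

  forward : ℕ → ℕ
  forward u with u <? q
  ... | yes _ = u + p
  ... | no  _ = u ∸ q

  backward : ℕ → ℕ
  backward u with u <? p
  ... | yes _ = u + q
  ... | no  _ = u ∸ p

  forward-low : ∀ {u} → u < q → forward u ≡ u + p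
  forward-low {u} u<q with u <? q
  ... | yes _   = refl
  ... | no  u≮q = contradiction u<q u≮q

  forward-high : ∀ {u} → ¬ u < q → forward u ≡ u ∸ q
  forward-high {u} u≮q with u <? q
  ... | yes u<q = contradiction u<q u≮q
  ... | no  _   = refl

  backward-low : ∀ {u} → u < p → backward u ≡ u + q
  backward-low {u} u<p with u <? p
  ... | yes _   = refl
  ... | no  u≮p = contradiction u<p u≮p

  backward-high : ∀ {u} → ¬ u < p → backward u ≡ u ∸ p
  backward-high {u} u≮p with u <? p
  ... | yes u<p = contradiction u<p u≮p
  ... | no  _   = refl

  label-low : ∀ {u} → u < q → label u ≡ true
  label-low {u} u<q with u <? q
  ... | yes _   = refl
  ... | no  u≮q = contradiction u<q u≮q

  drop-below-p : ∀ {u} → u < s → ¬ u < q → u ∸ q < p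
  drop-below-p {u} u<s u≮q = subst (u ∸ q <_) (m+n∸n≡m p q) (∸-monoˡ-< u<s (≮⇒≥ u≮q))

  drop-below-q : ∀ {u} → u < s → ¬ u < p → u ∸ p < q
  drop-below-q {u} u<s u≮p = subst (u ∸ p <_) (m+n∸m≡n p q) (∸-monoˡ-< u<s (≮⇒≥ u≮p))

  forward-< : ∀ {u} → u < s → forward u < s
  forward-< {u} u<s with u <? q
  ... | yes u<q = subst (u + p <_) (+-comm q p) (+-monoˡ-< p u<q)
  ... | no  _   = ≤-<-trans (m∸n≤m u q) u<s

  backward-< : ∀ {u} → u < s → backward u < s
  backward-< {u} u<s with u <? p
  ... | yes u<p = +-monoˡ-< q u<p
  ... | no  _   = ≤-<-trans (m∸n≤m u p) u<s

  backward-forward : ∀ {u} → u < s → backward (forward u) ≡ u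
  backward-forward {u} u<s with u <? q
  ... | yes _   = trans (backward-high (≤⇒≯ (m≤n+m p u))) (m+n∸n≡m u p)
  ... | no  u≮q = trans (backward-low (drop-below-p u<s u≮q)) (m∸n+n≡m (≮⇒≥ u≮q))

  forward-backward : ∀ {u} → u < s → forward (backward u) ≡ u
  forward-backward {u} u<s with u <? p
  ... | yes _   = trans (forward-high (≤⇒≯ (m≤n+m q u))) (m+n∸n≡m u q)
  ... | no  u≮p = trans (forward-low (drop-below-q u<s u≮p)) (m∸n+n≡m (≮⇒≥ u≮p))

  forward≢backward : 0 < p → p < q → ∀ u → forward u ≢ backward u
  forward≢backward 0<p p<q u with u <? q | u <? p
  ... | yes _   | yes _   = λ eq → <⇒≢ p<q (+-cancelˡ-≡ u p q eq)
  ... | yes _   | no  _   = λ eq → <⇒≢ (≤-<-trans (m∸n≤m u p) (m<m+n u 0<p)) (sym eq)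
  ... | no  u≮q | yes u<p = contradiction (<-trans u<p p<q) u≮q
  ... | no  u≮q | no  u≮p = λ eq → <⇒≢ p<q (sym (∸-cancelˡ-≡ (≮⇒≥ u≮q) (≮⇒≥ u≮p) eq))

  no-two-high : p < q → ∀ {u} → u < s → T (label u ∨ label (forward u))
  no-two-high p<q {u} u<s with u <? q
  ... | yes _   = tt
  ... | no  u≮q = subst T (sym (label-low (<-trans (drop-below-p u<s u≮q) p<q))) tt

infix 4 _≡±_
_≡±_ : ℤ → ℕ → Set
d ≡± a = d ≡ + a ⊎ d ≡ - (+ a)

≡±-neg : ∀ {d a} → d ≡± a → - d ≡± a
≡±-neg (inj₁ refl) = inj₂ refl
≡±-neg (inj₂ refl) = inj₁ (neg-involutive _)

δ-swap : ∀ {n} (x y : Fin n) → δ y x ≡ - δ x y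
δ-swap x y = begin
  + toℕ x - + toℕ y      ≡⟨ [+m]-[+n]≡m⊖n (toℕ x) (toℕ y) ⟩
  toℕ x ⊖ toℕ y          ≡⟨ ⊖-swap (toℕ x) (toℕ y) ⟩
  - (toℕ y ⊖ toℕ x)      ≡⟨ cong -_ (sym ([+m]-[+n]≡m⊖n (toℕ y) (toℕ x))) ⟩
  - (+ toℕ y - + toℕ x)  ∎
  where open ≡-Reasoning

rise : ∀ {a b} k → a + k ≡ b → + b - + a ≡ + k
rise {a} k refl = trans ([+m]-[+n]≡m⊖n (a + k) a) (trans (⊖-≥ (m≤m+n a k)) (cong +_ (m+n∸m≡n a k)))

fall : ∀ {a b} k → b + k ≡ a → + b - + a ≡ - (+ k)
fall {b = b} k refl = trans ([+m]-[+n]≡m⊖n b (b + k)) (trans (⊖-≤ (m≤m+n b k)) (cong (λ z → - (+ z)) (m+n∸m≡n b k)))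

module Board (p q : ℕ) (0<p : 0 < p) (p<q : p < q) where
  open Rotation p q

  X : Set
  X = Fin (side p q)

  offset : Bool → ℕ
  offset false = 0
  offset true  = s

  encode : Bool → ℕ → ℕ
  encode h u = offset h + u

  encode-< : ∀ h {u} → u < s → encode h u < side p q
  encode-< false     u<s = <-≤-trans u<s (m≤m+n s (s + 0))
  encode-< true {u}  u<s = +-monoʳ-< s (subst (u <_) (sym (+-identityʳ s)) u<s)

  encode-injective : ∀ h h′ {u u′} → u < s → u′ < s → encode h u ≡ encode h′ u′ → h ≡ h′ × u ≡ u′
  encode-injective false false _ _ eq = refl , eq
  encode-injective true  true  _ _ eq = refl , +-cancelˡ-≡ s _ _ eq
  encode-injective false true {u′ = u′} u<s _ eq = contradiction (subst (s ≤_) (sym eq) (m≤m+n s u′)) (<⇒≱ u<s)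
  encode-injective true  false {u = u} _ u′<s eq = contradiction (subst (s ≤_) eq (m≤m+n s u)) (<⇒≱ u′<s)

  bit : Fin 2 → Bool
  bit zero       = false
  bit (suc zero) = true

  half : X → Bool
  half x = bit (proj₁ (remQuot {2} s x))

  pos : X → ℕ
  pos x = toℕ (proj₂ (remQuot {2} s x))

  pos-< : ∀ x → pos x < s
  pos-< x = toℕ<n (proj₂ (remQuot {2} s x))

  toℕ-decode : ∀ x → toℕ x ≡ encode (half x) (pos x)
  toℕ-decode x = trans (cong toℕ (sym (combine-remQuot {2} s x))) (combine-encode (remQuot {2} s x))
    where
    combine-encode : ∀ (ij : Fin 2 × Fin s) →
      toℕ (combine (proj₁ ij) (proj₂ ij)) ≡ encode (bit (proj₁ ij)) (toℕ (proj₂ ij))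
    combine-encode (zero , j)     = trans (toℕ-combine {2} {s} zero j) (cong (_+ toℕ j) (*-zeroʳ s))
    combine-encode (suc zero , j) = trans (toℕ-combine {2} {s} (suc zero) j) (cong (_+ toℕ j) (*-identityʳ s))

  point : (h : Bool) (u : ℕ) → u < s → X
  point h u u<s = fromℕ< (encode-< h u<s)

  decode-point : ∀ h u (u<s : u < s) → half (point h u u<s) ≡ h × pos (point h u u<s) ≡ u
  decode-point h u u<s =
    encode-injective _ h (pos-< _) u<s (trans (sym (toℕ-decode (point h u u<s))) (toℕ-fromℕ< _))

  rotate : Bool → ℕ → ℕ
  rotate true  = forward
  rotate false = backward

  rotate-< : ∀ d {u} → u < s → rotate d u < s
  rotate-< true  = forward-<
  rotate-< false = backward-<

  rotate-reverse : ∀ d {u} → u < s → rotate (not d) (rotate d u) ≡ u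
  rotate-reverse true  = backward-forward
  rotate-reverse false = forward-backward

  rotate-injective : ∀ u {d d′} → rotate d u ≡ rotate d′ u → d ≡ d′
  rotate-injective u {true}  {true}  _  = refl
  rotate-injective u {false} {false} _  = refl
  rotate-injective u {true}  {false} eq = contradiction eq (forward≢backward 0<p p<q u)
  rotate-injective u {false} {true}  eq = contradiction (sym eq) (forward≢backward 0<p p<q u)

  window : ℕ → Window
  window u = label (backward (backward u)) , label (backward u) , label u , label (forward u)

  window-forward : ∀ {u} → u < s → window (forward u) ≡ shift F₀ (window u) (label (forward (forward u)))
  window-forward u<s rewrite backward-forward u<s = refl

  window-backward : ∀ {u} → u < s →
    window (backward u) ≡ shift B₀ (window u) (label (backward (backward (backward u))))
  window-backward u<s rewrite forward-backward u<s = refl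

  window-admissible : ∀ {u} → u < s → Admissible (window u)
  window-admissible u<s = Equivalence.from T-∧
    (high-then-low (backward-< u<s) , Equivalence.from T-∧ (high-then-low u<s , no-two-high p<q u<s))
    where
    high-then-low : ∀ {v} → v < s → T (label (backward v) ∨ label v)
    high-then-low {v} v<s = subst (λ w → T (label (backward v) ∨ label w)) (forward-backward v<s)
                                  (no-two-high p<q (backward-< v<s))

  view : X → View
  view x = half x , window (pos x)

  move : Move → X → X
  move (d , c) x = point (half x xor c) (rotate d (pos x)) (rotate-< d (pos-< x))

  half-move : ∀ m x → half (move m x) ≡ half x xor proj₂ m
  half-move (d , c) x = proj₁ (decode-point (half x xor c) (rotate d (pos x)) (rotate-< d (pos-< x)))

  pos-move : ∀ m x → pos (move m x) ≡ rotate (proj₁ m) (pos x)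
  pos-move (d , c) x = proj₂ (decode-point (half x xor c) (rotate d (pos x)) (rotate-< d (pos-< x)))

  view-move : ∀ m x → ∃[ n ] view (move m x) ≡ after m (view x) n
  view-move (true , c) x = _ , cong₂ _,_ (half-move (true , c) x)
    (trans (cong window (pos-move (true , c) x)) (window-forward (pos-< x)))
  view-move (false , c) x = _ , cong₂ _,_ (half-move (false , c) x)
    (trans (cong window (pos-move (false , c) x)) (window-backward (pos-< x)))

  xor-twice : ∀ h c → (h xor c) xor c ≡ h
  xor-twice h c = trans (xor-assoc h c c) (trans (cong (h xor_) (xor-same c)) (xor-identityʳ h))

  xor-cancelˡ : ∀ h {c c′} → h xor c ≡ h xor c′ → c ≡ c′
  xor-cancelˡ true  eq = not-injective eq
  xor-cancelˡ false eq = eq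

  move-reverse : ∀ m x → move (reverse m) (move m x) ≡ x
  move-reverse (d , c) x = toℕ-injective (begin
    toℕ (move (not d , c) y)                         ≡⟨ toℕ-fromℕ< _ ⟩
    encode (half y xor c) (rotate (not d) (pos y))   ≡⟨ cong₂ (λ h u → encode (h xor c) (rotate (not d) u))
                                                               (half-move (d , c) x) (pos-move (d , c) x) ⟩
    encode ((half x xor c) xor c) (rotate (not d) (rotate d (pos x)))
                                                     ≡⟨ cong₂ encode (xor-twice (half x) c) (rotate-reverse d (pos-< x)) ⟩
    encode (half x) (pos x)                          ≡⟨ sym (toℕ-decode x) ⟩
    toℕ x                                            ∎)
    where
    open ≡-Reasoning
    y = move (d , c) x

  move-injective : ∀ x {m m′} → move m x ≡ move m′ x → m ≡ m′
  move-injective x {d , c} {d′ , c′} eq = cong₂ _,_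
    (rotate-injective (pos x) (trans (sym (pos-move (d , c) x)) (trans (cong pos eq) (pos-move (d′ , c′) x))))
    (xor-cancelˡ (half x) (trans (sym (half-move (d , c) x)) (trans (cong half eq) (half-move (d′ , c′) x))))

  size : Bool → ℕ
  size true  = p
  size false = q

  Step : X → X → Bool → Set
  Step x y t = δ x y ≡± size t

  Step-sym : ∀ {x y t} → Step x y t → Step y x t
  Step-sym {x} {y} {t} step = subst (_≡± size t) (sym (δ-swap x y)) (≡±-neg step)

  forward-displacement : ∀ c h {u} → u < s → Valid (true , c) (h , window u) →
    + encode (h xor c) (forward u) - + encode h u ≡± size (label u xor c)
  forward-displacement false h {u} u<s _ rewrite xor-identityʳ h with u <? q
  ... | yes _   = inj₁ (rise p (+-assoc (offset h) u p))
  ... | no  u≮q = inj₂ (fall q (trans (+-assoc (offset h) (u ∸ q) q) (cong (λ z → offset h + z) (m∸n+n≡m (≮⇒≥ u≮q)))))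
  forward-displacement true h {u} u<s valid with u <? q
  forward-displacement true .true  {u} u<s refl | yes _   = inj₂ (fall q (rearrange u p q))
    where
    rearrange : ∀ u p q → (u + p) + q ≡ (p + q) + u
    rearrange = solve-∀
  forward-displacement true .false {u} u<s refl | no  u≮q =
    inj₁ (rise p (trans (cong (_+ p) (sym (m∸n+n≡m (≮⇒≥ u≮q)))) (rearrange (u ∸ q) p q)))
    where
    rearrange : ∀ v p q → (v + q) + p ≡ (p + q) + v
    rearrange = solve-∀

  forward-step : ∀ c x → Valid (true , c) (view x) →
    Step x (move (true , c) x) (stepType (true , c) (proj₂ (view x)))
  forward-step c x valid = subst₂ (λ a b → + a - + b ≡± size (label (pos x) xor c))
    (sym (toℕ-fromℕ< _)) (sym (toℕ-decode x)) (forward-displacement c (half x) (pos-< x) valid)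

  coordinates : LocalCoordinates X
  coordinates = record
    { Step = Step ; Step-sym = λ {x} {y} {t} → Step-sym {x} {y} {t}
    ; view = view ; move = move ; admissible = λ x → window-admissible (pos-< x)
    ; view-move = view-move ; move-reverse = move-reverse ; move-injective = move-injective
    ; forward-step = forward-step }

  open RuleTwoFactor coordinates public using (Adjacent; twoFactor)

  adjacent⇒leap : ∀ v w → Adjacent v w → W p q v w
  adjacent⇒leap _ _ (true  , step-x , step-y) = inj₁ (step-x , step-y)
  adjacent⇒leap _ _ (false , step-x , step-y) = inj₂ (step-x , step-y)

TwoFactor-mono : ∀ {V : Set} {E E′ : V → V → Set} → (∀ u v → E u v → E′ u v) → TwoFactor E → TwoFactor E′
TwoFactor-mono E⊆E′ (F , F⊆E , F-sym , degree) = F , (λ u v f → E⊆E′ u v (F⊆E u v f)) , F-sym , degree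

lemma1 : (p q : ℕ) → 0 < p → p < q → Coprime (q ∸ p) (p + q) →
    TwoFactor (W p q)
lemma1 p q 0<p p<q _ = TwoFactor-mono adjacent⇒leap twoFactor
  where open Board p q 0<p p<q
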